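{- For each positive integer $r$, $D_r(x_1,\ldots,x_r)=\varphi_r(x_1,\ldots,x_r)$.
   Context: $D_r(x_1,\ldots,x_r)=\det(I-M_r)$, where $M_r=(m_{ij})$ is the $r\times r$ matrix with $m_{ij}=x_j$ if $i+j\ge r+1$ and $m_{ij}=0$ otherwise, and $I$ is the identity. An odd composition is a finite sequence of odd positive integers; $\mathrm{OC}_{\le r}$ is the set of odd compositions of integers in $\{0,\ldots,r\}$ (including the empty one); $\ell(\alpha)$ is the number of parts of $\alpha$. Let $\sigma_r$ be the permutation of $\{1,\ldots,r\}$ with $\sigma_r(i)=i/2$ for $i$ even and $\sigma_r(i)=r+(1-i)/2$ for $i$ odd. Define \[ \varphi_r(x_1,\ldots,x_r)=\sum_{\alpha\in\mathrm{OC}_{\le r}}(-1)^{\lfloor(\ell(\alpha)+1)/2\rfloor}\prod_{i=1}^{\ell(\alpha)}x_{\sigma_r(\alpha_1+\cdots+\alpha_i)}. \] -}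

module Defs where

open import Level using (Level)
open import Data.Bool using (Bool; true; false; if_then_else_; _∧_)
open import Data.Nat using (ℕ; zero; suc; _∸_; _≤ᵇ_; ⌊_/2⌋) renaming (_+_ to _+ℕ_)
import Data.Nat
open import Data.Fin using (Fin; zero; suc; toℕ; punchIn)
open import Data.List using (List; []; _∷_; map; concatMap; filter; upTo; length; foldr; sum)
open import Algebra.Bundles using (CommutativeRing)
open import Relation.Nullary.Decidable using (yes; no)
open import Relation.Unary using (Decidable)
open import Relation.Binary.PropositionalEquality using (_≡_)
open import Data.Bool using (_≟_)

isEven : ℕ → Bool
isEven zero = true
isEven (suc n) with isEven n
... | true  = false
... | false = true

isOdd : ℕ → Bool
isOdd n = if isEven n then false else true

allOdd : List ℕ → Bool
allOdd [] = true
allOdd (a ∷ as) = isOdd a ∧ allOdd as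

-- compositions (sequences of positive integers) of exactly n,
-- computed with a fuel argument (fuel ≥ n suffices, since each part is ≥ 1)
compsFuel : ℕ → ℕ → List (List ℕ)
compsFuel _        zero    = [] ∷ []
compsFuel zero     (suc n) = []
compsFuel (suc f)  (suc n) =
  concatMap (λ k → map (suc k ∷_) (compsFuel f (n ∸ k))) (upTo (suc n))

compositions : ℕ → List (List ℕ)
compositions n = compsFuel n n

OCle : ℕ → List (List ℕ)
OCle r = filter (λ α → allOdd α ≟ true) (concatMap compositions (upTo (suc r)))

partialSums : List ℕ → List ℕ
partialSums = go 0
  where
  go : ℕ → List ℕ → List ℕ
  go s [] = []
  go s (a ∷ as) = (s +ℕ a) ∷ go (s +ℕ a) as

-- σ_r (on 1-based indices): σ_r(i) = i/2 (i even), r + (1-i)/2 = r - (i-1)/2 (i odd)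
σ : ℕ → ℕ → ℕ
σ r i = if isEven i then ⌊ i /2⌋ else r ∸ ⌊ (i ∸ 1) /2⌋

module _ {c ℓ : Level} (R : CommutativeRing c ℓ) where
  open CommutativeRing R using (Carrier; _+_; _*_; -_; _-_; 0#; 1#)

  signPow : ℕ → Carrier
  signPow n = if isEven n then 1# else - 1#

  sumFin : (n : ℕ) → (Fin n → Carrier) → Carrier
  sumFin zero    f = 0#
  sumFin (suc n) f = f zero + sumFin n (λ j → f (suc j))

  det : (n : ℕ) → (Fin n → Fin n → Carrier) → Carrier
  det zero    A = 1#
  det (suc n) A =
    sumFin (suc n) (λ j → signPow (toℕ j) * (A zero j * det n (λ i k → A (suc i) (punchIn j k))))

  Mmat : (r : ℕ) → (Fin r → Carrier) → Fin r → Fin r → Carrier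
  Mmat r x i j = if (suc r ≤ᵇ (suc (toℕ i) +ℕ suc (toℕ j))) then x j else 0#

  idMat : (r : ℕ) → Fin r → Fin r → Carrier
  idMat r i j = if (toℕ i Data.Nat.≡ᵇ toℕ j) then 1# else 0#

  D : (r : ℕ) → (Fin r → Carrier) → Carrier
  D r x = det r (λ i j → idMat r i j - Mmat r x i j)

  -- x_i for a 1-based index i ∈ {1,…,r}; (default 0# outside that range,
  -- which never occurs in φ_r)
  xAt : (r : ℕ) → (Fin r → Carrier) → ℕ → Carrier
  xAt zero    x i       = 0#
  xAt (suc r) x zero    = 0#
  xAt (suc r) x (suc zero) = x zero
  xAt (suc r) x (suc (suc i)) = xAt r (λ j → x (suc j)) (suc i)

  prodL : List Carrier → Carrier
  prodL = foldr _*_ 1#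

  sumL : List Carrier → Carrier
  sumL = foldr _+_ 0#

  φ : (r : ℕ) → (Fin r → Carrier) → Carrier
  φ r x = sumL (map term (OCle r))
    where
    term : List ℕ → Carrier
    term α = signPow ⌊ suc (length α) /2⌋ * prodL (map (λ s → xAt r x (σ r s)) (partialSums α))

-- Subtracting from every row of I − M_r the row above it leaves B_r: 1 on the diagonal, −1 just
-- below it, and −x_{l+1} in column l of the antidiagonal. Expanding B_r along its first row, and
-- B_r without its first row along its first column, gives two determinant recurrences of step 2
-- that are coupled to each other. Splitting an odd composition by whether its first part is 1 or
-- at least 3 gives the same recurrences for φ_r once the variables are read in the order
-- x_{σ_r(1)}, x_{σ_r(2)}, … = x_r, x_1, x_{r−1}, x_2, …, and the cases r = 0, 1 agree directly.
module Submission where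

open import Level using (0ℓ)
open import Algebra.Bundles using (CommutativeRing; RawRing)
open import Data.Bool using (Bool; true; false; not; if_then_else_; _≟_)
open import Data.Bool.Properties using (not-involutive)
open import Data.Fin using (Fin; zero; suc; toℕ; punchIn)
open import Data.Fin.Properties using (toℕ<n)
open import Data.List using (List; []; _∷_; map; _++_; concatMap; applyUpTo; upTo; filter; drop; length)
open import Data.List.Properties using (map-∘; map-cong; concatMap-cong)
open import Data.Maybe using (Maybe; just; nothing)
open import Data.Nat using (ℕ; zero; suc; _∸_; _≡ᵇ_; _≤ᵇ_; _<ᵇ_; ⌊_/2⌋; _<_; _≤_; z≤n; s≤s; z<s)
  renaming (_+_ to _+ℕ_; _*_ to _*ℕ_)
import Data.Nat.Properties as ℕ
open import Data.Product using (_×_; _,_; swap)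
open import Relation.Nullary using (yes; no)
open import Relation.Binary.PropositionalEquality as ≡ using (_≡_; cong; cong₂; subst)
import Algebra.Solver.Ring.AlmostCommutativeRing as ACR
open import Defs

module IntegerCoefficientSolver {c ℓ} (R : CommutativeRing c ℓ) where
  open CommutativeRing R
  open import Algebra.Properties.Ring ring using (-0#≈0#; x[y-z]≈xy-xz; [y-z]x≈yx-zx)
  open import Algebra.Properties.AbelianGroup +-abelianGroup using (⁻¹-anti-homo‿-; ⁻¹-∙-comm)
  open import Algebra.Properties.Group +-group using (x∙y⁻¹≈ε⇒x≈y; x≈y⇒x∙y⁻¹≈ε)
  open import Algebra.Properties.Semiring.Mult.TCOptimised semiring renaming (_×_ to _·_)
  open import Algebra.Definitions _≈_ using (Congruent₂)
  open import Relation.Binary.Reasoning.Setoid setoid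
  open import Algebra.Properties.CommutativeSemigroup +-commutativeSemigroup using (interchange)

  [x+z]-[y+w]≈[x-y]+[z-w] : ∀ x y z w → (x + z) - (y + w) ≈ (x - y) + (z - w)
  [x+z]-[y+w]≈[x-y]+[z-w] x y z w = begin
    (x + z) - (y + w)       ≈⟨ +-congˡ (⁻¹-∙-comm y w) ⟨
    (x + z) + (- y + - w)   ≈⟨ interchange x z (- y) (- w) ⟩
    (x - y) + (z - w)       ∎

  [x-y]-[z-w]≈[x+w]-[y+z] : ∀ x y z w → (x - y) - (z - w) ≈ (x + w) - (y + z)
  [x-y]-[z-w]≈[x+w]-[y+z] x y z w = begin
    (x - y) - (z - w)      ≈⟨ +-congˡ (⁻¹-anti-homo‿- z w) ⟩
    (x - y) + (w - z)      ≈⟨ [x+z]-[y+w]≈[x-y]+[z-w] x y w z ⟨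
    (x + w) - (y + z)      ∎

  -- Integer coefficients: (a , b) stands for a − b. The pairs are never normalised, since the
  -- solver only needs the sound equality test _≟ᵈ_ below.
  _+ᵈ_ _*ᵈ_ : ℕ × ℕ → ℕ × ℕ → ℕ × ℕ
  (a , b) +ᵈ (a′ , b′) = (a +ℕ a′ , b +ℕ b′)
  (a , b) *ᵈ (a′ , b′) = (a *ℕ a′ +ℕ b *ℕ b′ , a *ℕ b′ +ℕ b *ℕ a′)

  Difference : RawRing 0ℓ 0ℓ
  Difference = record
    { Carrier = ℕ × ℕ
    ; _≈_ = _≡_
    ; _+_ = _+ᵈ_
    ; _*_ = _*ᵈ_
    ; -_ = swap
    ; 0# = (0 , 0)
    ; 1# = (1 , 0)
    }

  value : ℕ × ℕ → Carrier
  value (a , b) = a · 1# - b · 1#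

  value-homo-+ : ∀ x y → value (x +ᵈ y) ≈ value x + value y
  value-homo-+ (a , b) (a′ , b′) = trans
    (+-cong (×-homo-+ 1# a a′) (-‿cong (×-homo-+ 1# b b′)))
    ([x+z]-[y+w]≈[x-y]+[z-w] (a · 1#) (b · 1#) (a′ · 1#) (b′ · 1#))

  value-homo-* : ∀ x y → value (x *ᵈ y) ≈ value x * value y
  value-homo-* (a , b) (a′ , b′) = begin
    (a *ℕ a′ +ℕ b *ℕ b′) · 1# - (a *ℕ b′ +ℕ b *ℕ a′) · 1#
      ≈⟨ +-cong (trans (×-homo-+ 1# (a *ℕ a′) (b *ℕ b′)) (+-cong (×1-homo-* a a′) (×1-homo-* b b′)))
                (-‿cong (trans (×-homo-+ 1# (a *ℕ b′) (b *ℕ a′)) (+-cong (×1-homo-* a b′) (×1-homo-* b a′)))) ⟩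
    (x * x′ + y * y′) - (x * y′ + y * x′)  ≈⟨ [x-y]-[z-w]≈[x+w]-[y+z] (x * x′) (x * y′) (y * x′) (y * y′) ⟨
    (x * x′ - x * y′) - (y * x′ - y * y′)  ≈⟨ +-cong (x[y-z]≈xy-xz x x′ y′) (-‿cong (x[y-z]≈xy-xz y x′ y′)) ⟨
    x * (x′ - y′) - y * (x′ - y′)          ≈⟨ [y-z]x≈yx-zx (x′ - y′) x y ⟨
    (x - y) * (x′ - y′)                    ∎
    where
    x y x′ y′ : Carrier
    x = a · 1#
    y = b · 1#
    x′ = a′ · 1#
    y′ = b′ · 1#

  -- Without the "- 0#" for b = 0 the constants (0 , 0) and (1 , 0) evaluate to 0# and 1# themselves.
  ⟦_⟧ : ℕ × ℕ → Carrier
  ⟦ (a , zero) ⟧ = a · 1#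
  ⟦ (a , b) ⟧ = value (a , b)

  ⟦⟧≈value : ∀ x → ⟦ x ⟧ ≈ value x
  ⟦⟧≈value (a , zero) = sym (trans (+-congˡ -0#≈0#) (+-identityʳ _))
  ⟦⟧≈value (a , suc b) = refl

  ⟦⟧-homo₂ : (op : ℕ × ℕ → ℕ × ℕ → ℕ × ℕ) (_∙_ : Carrier → Carrier → Carrier) → Congruent₂ _∙_ →
             (∀ x y → value (op x y) ≈ value x ∙ value y) → ∀ x y → ⟦ op x y ⟧ ≈ ⟦ x ⟧ ∙ ⟦ y ⟧
  ⟦⟧-homo₂ op _∙_ ∙-cong homo x y =
    trans (⟦⟧≈value (op x y)) (trans (homo x y) (sym (∙-cong (⟦⟧≈value x) (⟦⟧≈value y))))

  differenceMorphism : Difference ACR.-Raw-AlmostCommutative⟶ ACR.fromCommutativeRing R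
  differenceMorphism = record
    { ⟦_⟧ = ⟦_⟧
    ; +-homo = ⟦⟧-homo₂ _+ᵈ_ _+_ +-cong value-homo-+
    ; *-homo = ⟦⟧-homo₂ _*ᵈ_ _*_ *-cong value-homo-*
    ; -‿homo = λ (a , b) → trans (⟦⟧≈value (b , a))
        (trans (sym (⁻¹-anti-homo‿- (a · 1#) (b · 1#))) (-‿cong (sym (⟦⟧≈value (a , b)))))
    ; 0-homo = refl
    ; 1-homo = refl
    }

  _≟ᵈ_ : ∀ x y → Maybe (⟦ x ⟧ ≈ ⟦ y ⟧)
  (a , b) ≟ᵈ (a′ , b′) with a +ℕ b′ ℕ.≟ a′ +ℕ b
  ... | no _ = nothing
  ... | yes e = just (trans (⟦⟧≈value (a , b)) (trans equal (sym (⟦⟧≈value (a′ , b′)))))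
    where
    equal : value (a , b) ≈ value (a′ , b′)
    equal = x∙y⁻¹≈ε⇒x≈y _ _ (trans ([x-y]-[z-w]≈[x+w]-[y+z] _ _ _ _) (x≈y⇒x∙y⁻¹≈ε (begin
      a · 1# + b′ · 1#   ≈⟨ ×-homo-+ 1# a b′ ⟨
      (a +ℕ b′) · 1#     ≡⟨ cong (_· 1#) e ⟩
      (a′ +ℕ b) · 1#     ≈⟨ ×-homo-+ 1# a′ b ⟩
      a′ · 1# + b · 1#   ≈⟨ +-comm _ _ ⟩
      b · 1# + a′ · 1#   ∎)))

  open import Algebra.Solver.Ring Difference (ACR.fromCommutativeRing R) differenceMorphism _≟ᵈ_ public
    using (solve; Polynomial; _:=_; _:+_; _:*_; :-_; _:-_; con)

  :0 :1 : ∀ {n} → Polynomial n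
  :0 = con (0 , 0)
  :1 = con (1 , 0)

isEven-suc : ∀ n → isEven (suc n) ≡ not (isEven n)
isEven-suc n with isEven n
... | true  = ≡.refl
... | false = ≡.refl

isEven-suc-suc : ∀ n → isEven (suc (suc n)) ≡ isEven n
isEven-suc-suc n = ≡.trans (isEven-suc (suc n)) (≡.trans (cong not (isEven-suc n)) (not-involutive (isEven n)))

punchInℕ : ℕ → ℕ → ℕ
punchInℕ zero    k       = suc k
punchInℕ (suc i) zero    = zero
punchInℕ (suc i) (suc k) = suc (punchInℕ i k)

toℕ-punchIn : ∀ {n} (j : Fin (suc n)) (l : Fin n) → toℕ (punchIn j l) ≡ punchInℕ (toℕ j) (toℕ l)
toℕ-punchIn zero    l       = ≡.refl
toℕ-punchIn (suc j) zero    = ≡.refl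
toℕ-punchIn (suc j) (suc l) = cong suc (toℕ-punchIn j l)

punchInℕ-< : ∀ {n j l} → j ≤ n → l < n → punchInℕ j l < suc n
punchInℕ-< {j = zero}  _ l<n = s≤s l<n
punchInℕ-< {j = suc j} {l = zero}  _ _ = s≤s z≤n
punchInℕ-< {j = suc j} {l = suc l} (s≤s j≤n) (s≤s l<n) = s≤s (punchInℕ-< j≤n l<n)

punchInℕ-below : ∀ {j l} → l < j → punchInℕ j l ≡ l
punchInℕ-below {suc j} {zero}  _ = ≡.refl
punchInℕ-below {suc j} {suc l} (s≤s l<j) = cong suc (punchInℕ-below l<j)

punchInℕ-above : ∀ {j l} → j ≤ l → punchInℕ j l ≡ suc l
punchInℕ-above {zero}  _ = ≡.refl
punchInℕ-above {suc j} {suc l} (s≤s j≤l) = cong suc (punchInℕ-above j≤l)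

m<n+1+m : ∀ m n → m < n +ℕ suc m
m<n+1+m m n = subst (m <_) (≡.sym (ℕ.+-suc n m)) (s≤s (ℕ.m≤n+m m n))

partialSums-cons : ∀ a α → partialSums (a ∷ α) ≡ a ∷ map (a +ℕ_) (partialSums α)
partialSums-cons a α = cong (a ∷_) (tail-partialSums a α)
  where
  open ≡.≡-Reasoning
  -- The running-sum helper of partialSums is local to Defs; drop 1 (partialSums (a ∷ α)) is
  -- that helper started at a.
  tail-partialSums : ∀ a α → drop 1 (partialSums (a ∷ α)) ≡ map (a +ℕ_) (partialSums α)
  tail-partialSums a []      = ≡.refl
  tail-partialSums a (b ∷ α) = cong ((a +ℕ b) ∷_) (begin
    drop 1 (partialSums (a +ℕ b ∷ α))           ≡⟨ tail-partialSums (a +ℕ b) α ⟩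
    map ((a +ℕ b) +ℕ_) (partialSums α)          ≡⟨ map-cong (ℕ.+-assoc a b) (partialSums α) ⟩
    map (λ t → a +ℕ (b +ℕ t)) (partialSums α)   ≡⟨ map-∘ (partialSums α) ⟩
    map (a +ℕ_) (map (b +ℕ_) (partialSums α))   ≡⟨ cong (map (a +ℕ_)) (tail-partialSums b α) ⟨
    map (a +ℕ_) (drop 1 (partialSums (b ∷ α)))  ∎)

compsFuel-fuel : ∀ {f f′ n} → n ≤ f → n ≤ f′ → compsFuel f n ≡ compsFuel f′ n
compsFuel-fuel {n = zero} _ _ = ≡.refl
compsFuel-fuel {suc f} {suc f′} {suc n} (s≤s n≤f) (s≤s n≤f′) = concatMap-cong
  (λ k → cong (map (suc k ∷_)) (compsFuel-fuel (ℕ.≤-trans (ℕ.m∸n≤m n k) n≤f) (ℕ.≤-trans (ℕ.m∸n≤m n k) n≤f′)))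
  (upTo (suc n))

-- lastFirst m lists 0, …, m − 1 as m − 1, 0, m − 2, 1, …, and firstLast m as 0, m − 1, 1, m − 2, …
-- (both are junk beyond position m − 1).
lastFirst firstLast : ℕ → ℕ → ℕ
lastFirst zero    p       = 0
lastFirst (suc m) zero    = m
lastFirst (suc m) (suc p) = firstLast m p
firstLast zero    p       = 0
firstLast (suc m) zero    = 0
firstLast (suc m) (suc p) = suc (lastFirst m p)

σ-shift : ∀ m p → p < m → σ (suc (suc m)) (suc (suc (suc p))) ≡ suc (σ m (suc p))
σ-shift m p p<m rewrite isEven-suc-suc (suc p) with isEven (suc p)
... | true  = ≡.refl
... | false = ℕ.+-∸-assoc 1 (ℕ.≤-trans (ℕ.⌊n/2⌋≤n p) (ℕ.<⇒≤ p<m))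

σ-lastFirst : ∀ m p → p < m → σ m (suc p) ≡ suc (lastFirst m p)
σ-lastFirst (suc m)       zero          _ = ≡.refl
σ-lastFirst (suc zero)    (suc zero)    (s≤s ())
σ-lastFirst (suc (suc m)) (suc zero)    _ = ≡.refl
σ-lastFirst (suc (suc m)) (suc (suc p)) (s≤s (s≤s p<m)) =
  ≡.trans (σ-shift m p p<m) (cong suc (σ-lastFirst m p p<m))

module _ {c ℓ} (R : CommutativeRing c ℓ) where
  open CommutativeRing R hiding (zero)
  open import Algebra.Properties.Ring ring using (-0#≈0#; -‿involutive; -‿distribˡ-*)
  open import Algebra.Properties.AbelianGroup +-abelianGroup using (⁻¹-∙-comm)
  open import Algebra.Properties.Semiring.Sum semiring
    using (sum; sum-cong-≋; sum-replicate-zero; ∑-distrib-+; ∑-comm; *-distribˡ-sum)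
  open import Relation.Binary.Reasoning.Setoid setoid
  open IntegerCoefficientSolver R

  private
    s : ℕ → Carrier
    s = signPow R

  signPow-suc : ∀ n → s (suc n) ≈ - s n
  signPow-suc n rewrite isEven-suc n with isEven n
  ... | true  = refl
  ... | false = sym (-‿involutive 1#)

  signPow-square : ∀ n → s n * s n ≈ 1#
  signPow-square n with isEven n
  ... | true  = *-identityˡ 1#
  ... | false = solve 0 ((:- :1) :* (:- :1) := :1) refl

  -- Opaque, so that unification can read off the summand of Σ< n f.
  opaque
    Σ< : ℕ → (ℕ → Carrier) → Carrier
    Σ< n f = sum {n} (λ i → f (toℕ i))

  opaque
    unfolding Σ<

    Σ<-0 : ∀ (f : ℕ → Carrier) → Σ< 0 f ≈ 0#
    Σ<-0 f = refl

    Σ<-suc : ∀ n (f : ℕ → Carrier) → Σ< (suc n) f ≈ f 0 + Σ< n (λ i → f (suc i))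
    Σ<-suc n f = refl

    Σ<-one : ∀ (f : ℕ → Carrier) → Σ< 1 f ≈ f 0
    Σ<-one f = +-identityʳ (f 0)

    Σ<-cong : ∀ n {f g : ℕ → Carrier} → (∀ i → i < n → f i ≈ g i) → Σ< n f ≈ Σ< n g
    Σ<-cong n f≈g = sum-cong-≋ (λ i → f≈g (toℕ i) (toℕ<n i))

    Σ<-zero : ∀ n {f : ℕ → Carrier} → (∀ i → i < n → f i ≈ 0#) → Σ< n f ≈ 0#
    Σ<-zero n f≈0 = trans (Σ<-cong n f≈0) (sum-replicate-zero n)

    Σ<-distrib-+ : ∀ n (f g : ℕ → Carrier) → Σ< n (λ i → f i + g i) ≈ Σ< n f + Σ< n g
    Σ<-distrib-+ n f g = ∑-distrib-+ {n} (λ i → f (toℕ i)) (λ i → g (toℕ i))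

    -‿Σ< : ∀ n (f : ℕ → Carrier) → Σ< n (λ i → - f i) ≈ - Σ< n f
    -‿Σ< zero    f = sym -0#≈0#
    -‿Σ< (suc n) f = trans (+-congˡ (-‿Σ< n (λ i → f (suc i)))) (⁻¹-∙-comm _ _)

    Σ<-distrib-- : ∀ n (f g : ℕ → Carrier) → Σ< n (λ i → f i - g i) ≈ Σ< n f - Σ< n g
    Σ<-distrib-- n f g = trans (Σ<-distrib-+ n f (λ i → - g i)) (+-congˡ (-‿Σ< n g))

    *-distribˡ-Σ< : ∀ n x (f : ℕ → Carrier) → x * Σ< n f ≈ Σ< n (λ i → x * f i)
    *-distribˡ-Σ< n x f = *-distribˡ-sum {n} x (λ i → f (toℕ i))

    Σ<-comm : ∀ m n (f : ℕ → ℕ → Carrier) → Σ< m (λ i → Σ< n (f i)) ≈ Σ< n (λ j → Σ< m (λ i → f i j))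
    Σ<-comm m n f = ∑-comm {m} {n} (λ i j → f (toℕ i) (toℕ j))

    Σ<-last : ∀ n (f : ℕ → Carrier) → Σ< (suc n) f ≈ Σ< n f + f n
    Σ<-last zero    f = trans (+-identityʳ (f 0)) (sym (+-identityˡ (f 0)))
    Σ<-last (suc n) f = trans (+-congˡ (Σ<-last n (λ i → f (suc i)))) (sym (+-assoc _ _ _))

    sumFin≈Σ< : ∀ n {f : Fin n → Carrier} {g : ℕ → Carrier} → (∀ i → f i ≈ g (toℕ i)) → sumFin R n f ≈ Σ< n g
    sumFin≈Σ< zero    f≈g = refl
    sumFin≈Σ< (suc n) {g = g} f≈g = +-cong (f≈g zero) (sumFin≈Σ< n {g = λ i → g (suc i)} (λ i → f≈g (suc i)))

  Σ<-ends : ∀ m {f : ℕ → Carrier} {a b} → f 0 ≈ a → (∀ j → j < m → f (suc j) ≈ 0#) → f (suc m) ≈ b →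
            Σ< (suc (suc m)) f ≈ a + b
  Σ<-ends m {f} {a} {b} first middle last = begin
    Σ< (suc (suc m)) f                                ≈⟨ trans (Σ<-suc (suc m) f) (+-congˡ (Σ<-last m _)) ⟩
    f 0 + (Σ< m (λ j → f (suc j)) + f (suc m))        ≈⟨ +-cong first (+-cong (Σ<-zero m middle) last) ⟩
    a + (0# + b)                                      ≈⟨ +-congˡ (+-identityˡ b) ⟩
    a + b                                             ∎

  ΣL : ∀ {A : Set} → (A → Carrier) → List A → Carrier
  ΣL f L = sumL R (map f L)

  ΣL-cong : ∀ {A : Set} {f g : A → Carrier} L → (∀ a → f a ≈ g a) → ΣL f L ≈ ΣL g L
  ΣL-cong []      f≈g = refl
  ΣL-cong (a ∷ L) f≈g = +-cong (f≈g a) (ΣL-cong L f≈g)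

  ΣL-++ : ∀ {A : Set} (f : A → Carrier) L L′ → ΣL f (L ++ L′) ≈ ΣL f L + ΣL f L′
  ΣL-++ f []      L′ = sym (+-identityˡ _)
  ΣL-++ f (a ∷ L) L′ = trans (+-congˡ (ΣL-++ f L L′)) (sym (+-assoc _ _ _))

  ΣL-concatMap : ∀ {A B : Set} (f : B → Carrier) (g : A → List B) L → ΣL f (concatMap g L) ≈ ΣL (λ a → ΣL f (g a)) L
  ΣL-concatMap f g []      = refl
  ΣL-concatMap f g (a ∷ L) = trans (ΣL-++ f (g a) (concatMap g L)) (+-congˡ (ΣL-concatMap f g L))

  ΣL-map : ∀ {A B : Set} (f : B → Carrier) (g : A → B) L → ΣL f (map g L) ≈ ΣL (λ a → f (g a)) L
  ΣL-map f g L = reflexive (cong (sumL R) (≡.sym (map-∘ L)))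

  ΣL-applyUpTo : ∀ (f : ℕ → Carrier) (g : ℕ → ℕ) n → ΣL f (applyUpTo g n) ≈ Σ< n (λ i → f (g i))
  ΣL-applyUpTo f g zero    = sym (Σ<-0 _)
  ΣL-applyUpTo f g (suc n) = trans (+-congˡ (ΣL-applyUpTo f (λ i → g (suc i)) n)) (sym (Σ<-suc n _))

  *-distribˡ-ΣL : ∀ {A : Set} x (f : A → Carrier) L → x * ΣL f L ≈ ΣL (λ a → x * f a) L
  *-distribˡ-ΣL x f []      = zeroʳ x
  *-distribˡ-ΣL x f (a ∷ L) = trans (distribˡ x _ _) (+-congˡ (*-distribˡ-ΣL x f L))

  ΣL-const-0# : ∀ {A : Set} (L : List A) → ΣL (λ _ → 0#) L ≈ 0#
  ΣL-const-0# []      = refl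
  ΣL-const-0# (a ∷ L) = trans (+-identityˡ _) (ΣL-const-0# L)

  -‿ΣL : ∀ {A : Set} (f : A → Carrier) L → ΣL (λ a → - f a) L ≈ - ΣL f L
  -‿ΣL f []      = sym -0#≈0#
  -‿ΣL f (a ∷ L) = trans (+-congˡ (-‿ΣL f L)) (⁻¹-∙-comm _ _)

  ΣL-filter : ∀ {A : Set} (p : A → Bool) (f : A → Carrier) L →
              ΣL f (filter (λ a → p a ≟ true) L) ≈ ΣL (λ a → if p a then f a else 0#) L
  ΣL-filter p f [] = refl
  ΣL-filter p f (a ∷ L) with p a
  ... | true  = +-congˡ (ΣL-filter p f L)
  ... | false = trans (ΣL-filter p f L) (sym (+-identityˡ _))

  ΣL-if : ∀ {A : Set} b x (f : A → Carrier) L →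
          ΣL (λ a → if b then x * f a else 0#) L ≈ (if b then x * ΣL f L else 0#)
  ΣL-if true  x f L = sym (*-distribˡ-ΣL x f L)
  ΣL-if false x f L = ΣL-const-0# L

  if-cong : ∀ {b b′ x y} → b ≡ b′ → x ≈ y → (if b then x else 0#) ≈ (if b′ then y else 0#)
  if-cong {true}  ≡.refl x≈y = x≈y
  if-cong {false} ≡.refl _   = refl

  -- Determinants of leading blocks

  Matrix : Set c
  Matrix = ℕ → ℕ → Carrier

  minor : ℕ → ℕ → Matrix → Matrix
  minor i j A k l = A (punchInℕ i k) (punchInℕ j l)

  detℕ : ℕ → Matrix → Carrier
  detℕ zero    A = 1#
  detℕ (suc n) A = Σ< (suc n) (λ j → s j * (A 0 j * detℕ n (minor 0 j A)))

  det≈detℕ : ∀ n {A′ : Fin n → Fin n → Carrier} {A : Matrix} →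
             (∀ i j → A′ i j ≈ A (toℕ i) (toℕ j)) → det R n A′ ≈ detℕ n A
  det≈detℕ zero    A′≈A = refl
  det≈detℕ (suc n) {A = A} A′≈A = sumFin≈Σ< (suc n) λ j → *-congˡ (*-cong (A′≈A zero j)
    (det≈detℕ n λ k l → trans (A′≈A (suc k) (punchIn j l)) (reflexive (cong (A (suc (toℕ k))) (toℕ-punchIn j l)))))

  detℕ-cong : ∀ n {A B : Matrix} → (∀ k l → k < n → l < n → A k l ≈ B k l) → detℕ n A ≈ detℕ n B
  detℕ-cong zero    A≈B = refl
  detℕ-cong (suc n) A≈B = Σ<-cong (suc n) λ j j<n → *-congˡ (*-cong (A≈B 0 j z<s j<n)
    (detℕ-cong n λ k l k<n l<n → A≈B (suc k) _ (s≤s k<n) (punchInℕ-< (ℕ.≤-pred j<n) l<n)))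

  detℕ-1 : ∀ A → detℕ 1 A ≈ A 0 0
  detℕ-1 A = trans (Σ<-one _) (solve 1 (λ a → :1 :* (a :* :1) := a) refl (A 0 0))

  detℕ-expandColumn₀ : ∀ n A → detℕ (suc n) A ≈ Σ< (suc n) (λ i → s i * (A i 0 * detℕ n (minor i 0 A)))
  detℕ-expandColumn₀ zero    A = Σ<-cong 1 λ { zero _ → refl ; (suc _) (s≤s ()) }
  detℕ-expandColumn₀ (suc n) A = trans (Σ<-suc (suc n) _) (trans (+-congˡ (begin
    Σ< (suc n) (λ j → s (suc j) * (a j * detℕ (suc n) (minor 0 (suc j) A)))
      ≈⟨ Σ<-cong (suc n) (λ j _ → *-congˡ (*-congˡ (detℕ-expandColumn₀ n (minor 0 (suc j) A)))) ⟩
    Σ< (suc n) (λ j → s (suc j) * (a j * Σ< (suc n) (λ i → s i * (b i * d i j))))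
      ≈⟨ Σ<-cong (suc n) (λ j _ → scale-Σ< (s (suc j)) (a j)) ⟩
    Σ< (suc n) (λ j → Σ< (suc n) (λ i → s (suc j) * (a j * (s i * (b i * d i j)))))
      ≈⟨ Σ<-comm (suc n) (suc n) _ ⟩
    Σ< (suc n) (λ i → Σ< (suc n) (λ j → s (suc j) * (a j * (s i * (b i * d i j)))))
      ≈⟨ Σ<-cong (suc n) (λ i _ → Σ<-cong (suc n) (λ j _ → swap-signs i j)) ⟩
    Σ< (suc n) (λ i → Σ< (suc n) (λ j → s (suc i) * (b i * (s j * (a j * d i j)))))
      ≈⟨ Σ<-cong (suc n) (λ i _ → scale-Σ< (s (suc i)) (b i)) ⟨
    Σ< (suc n) (λ i → s (suc i) * (b i * Σ< (suc n) (λ j → s j * (a j * d i j))))  ∎)) (sym (Σ<-suc (suc n) _)))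
    where
    a b : ℕ → Carrier
    a j = A 0 (suc j)
    b i = A (suc i) 0
    d : ℕ → ℕ → Carrier
    d i j = detℕ n (λ k l → A (suc (punchInℕ i k)) (suc (punchInℕ j l)))
    scale-Σ< : ∀ x y {f} → x * (y * Σ< (suc n) f) ≈ Σ< (suc n) (λ i → x * (y * f i))
    scale-Σ< x y {f} = trans (*-congˡ (*-distribˡ-Σ< (suc n) y f)) (*-distribˡ-Σ< (suc n) x _)
    swap-signs : ∀ i j → s (suc j) * (a j * (s i * (b i * d i j))) ≈ s (suc i) * (b i * (s j * (a j * d i j)))
    swap-signs i j = begin
      s (suc j) * (a j * (s i * (b i * d i j)))  ≈⟨ *-congʳ (signPow-suc j) ⟩
      - s j * (a j * (s i * (b i * d i j)))      ≈⟨ solve 5 (λ x y p q e → (:- x) :* (p :* (y :* (q :* e))) := (:- y) :* (q :* (x :* (p :* e)))) refl (s j) (s i) (a j) (b i) (d i j) ⟩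
      - s i * (b i * (s j * (a j * d i j)))      ≈⟨ *-congʳ (signPow-suc i) ⟨
      s (suc i) * (b i * (s j * (a j * d i j)))  ∎

  detℕ-equalRows₀₁ : ∀ n A → (∀ l → A 0 l ≈ A 1 l) → detℕ (suc (suc n)) A ≈ 0#
  detℕ-equalRows₀₁ n A row₀≈row₁ = begin
    detℕ (suc (suc n)) A                           ≈⟨ detℕ-expandColumn₀ (suc n) A ⟩
    Σ< (suc (suc n)) t                             ≈⟨ trans (Σ<-suc (suc n) t) (+-congˡ (Σ<-suc n _)) ⟩
    t 0 + (t 1 + Σ< n (λ i → t (suc (suc i))))     ≈⟨ +-congˡ (+-congˡ (Σ<-zero n later-terms)) ⟩
    t 0 + (t 1 + 0#)                               ≈⟨ +-congˡ (+-congʳ (*-congˡ (*-cong (sym (row₀≈row₁ 0)) (sym minors-agree)))) ⟩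
    t 0 + (- 1# * (A 0 0 * d) + 0#)                ≈⟨ solve 2 (λ a d → :1 :* (a :* d) :+ ((:- :1) :* (a :* d) :+ :0) := :0) refl (A 0 0) d ⟩
    0#                                             ∎
    where
    t : ℕ → Carrier
    t i = s i * (A i 0 * detℕ (suc n) (minor i 0 A))
    d : Carrier
    d = detℕ (suc n) (minor 0 0 A)
    minors-agree : d ≈ detℕ (suc n) (minor 1 0 A)
    minors-agree = detℕ-cong (suc n) {minor 0 0 A} {minor 1 0 A} λ where
      zero    l _ _ → sym (row₀≈row₁ (suc l))
      (suc k) l _ _ → refl
    -- Rows 0 and 1 of B are also rows 0 and 1 of its minors below row 1.
    vanish : ∀ m i B → i < m → (∀ l → B 0 l ≈ B 1 l) → detℕ (suc m) (minor (suc (suc i)) 0 B) ≈ 0#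
    vanish (suc m) i B _ B₀≈B₁ = detℕ-equalRows₀₁ m (minor (suc (suc i)) 0 B) (λ l → B₀≈B₁ (suc l))
    later-terms : ∀ i → i < n → t (suc (suc i)) ≈ 0#
    later-terms i i<n = trans (*-congˡ (trans (*-congˡ (vanish n i A i<n row₀≈row₁)) (zeroʳ _))) (zeroʳ _)

  detℕ-linear-row₀ : ∀ n {X Y Z : Matrix} → (∀ l → X 0 l ≈ Y 0 l - Z 0 l) →
    (∀ k l → X (suc k) l ≈ Y (suc k) l) → (∀ k l → X (suc k) l ≈ Z (suc k) l) →
    detℕ (suc n) X ≈ detℕ (suc n) Y - detℕ (suc n) Z
  detℕ-linear-row₀ n {X} {Y} {Z} row₀ X≈Y X≈Z = trans (Σ<-cong (suc n) λ j _ → begin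
      s j * (X 0 j * detℕ n (minor 0 j X))
        ≈⟨ *-congˡ (*-congʳ (row₀ j)) ⟩
      s j * ((Y 0 j - Z 0 j) * detℕ n (minor 0 j X))
        ≈⟨ solve 4 (λ σ y z d → σ :* ((y :- z) :* d) := σ :* (y :* d) :- σ :* (z :* d)) refl _ _ _ _ ⟩
      s j * (Y 0 j * detℕ n (minor 0 j X)) - s j * (Z 0 j * detℕ n (minor 0 j X))
        ≈⟨ +-cong (*-congˡ (*-congˡ (detℕ-cong n λ k l _ _ → X≈Y k _)))
                  (-‿cong (*-congˡ (*-congˡ (detℕ-cong n λ k l _ _ → X≈Z k _)))) ⟩
      s j * (Y 0 j * detℕ n (minor 0 j Y)) - s j * (Z 0 j * detℕ n (minor 0 j Z))  ∎)
    (Σ<-distrib-- (suc n) _ _)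

  rowDifferences : Matrix → Matrix
  rowDifferences A zero    l = A zero l
  rowDifferences A (suc k) l = A (suc k) l - A k l

  detℕ-rowDifferences : ∀ n A → detℕ n (rowDifferences A) ≈ detℕ n A
  detℕ-rowDifferences zero          A = refl
  detℕ-rowDifferences (suc zero)    A = refl
  detℕ-rowDifferences (suc (suc n)) A = begin
    detℕ (suc (suc n)) (rowDifferences A)
      ≈⟨ Σ<-cong (suc (suc n)) (λ j _ → *-congˡ (*-congˡ (minor-split j (detℕ-rowDifferences (suc n) (minor 0 j A))))) ⟩
    Σ< (suc (suc n)) (λ j → s j * (A 0 j * (detℕ (suc n) (minor 0 j A) - detℕ (suc n) (minor 0 j A′))))
      ≈⟨ Σ<-cong (suc (suc n)) (λ j _ → solve 4 (λ σ a d e → σ :* (a :* (d :- e)) := σ :* (a :* d) :- σ :* (a :* e)) refl _ _ _ _) ⟩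
    Σ< (suc (suc n)) (λ j → s j * (A 0 j * detℕ (suc n) (minor 0 j A)) - s j * (A 0 j * detℕ (suc n) (minor 0 j A′)))
      ≈⟨ Σ<-distrib-- (suc (suc n)) _ _ ⟩
    detℕ (suc (suc n)) A - detℕ (suc (suc n)) A′
      ≈⟨ +-congˡ (-‿cong (detℕ-equalRows₀₁ n A′ (λ _ → refl))) ⟩
    detℕ (suc (suc n)) A - 0#
      ≈⟨ trans (+-congˡ -0#≈0#) (+-identityʳ _) ⟩
    detℕ (suc (suc n)) A  ∎
    where
    -- Row 1 of rowDifferences A is A₁ − A₀; splitting it by linearity leaves this matrix,
    -- whose rows 0 and 1 are both A₀.
    A′ : Matrix
    A′ zero          = A zero
    A′ (suc zero)    = A zero
    A′ (suc (suc k)) = rowDifferences A (suc (suc k))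
    minor-split : ∀ j → detℕ (suc n) (rowDifferences (minor 0 j A)) ≈ detℕ (suc n) (minor 0 j A) →
                  detℕ (suc n) (minor 0 j (rowDifferences A)) ≈ detℕ (suc n) (minor 0 j A) - detℕ (suc n) (minor 0 j A′)
    minor-split j ih = trans
      (detℕ-linear-row₀ n {minor 0 j (rowDifferences A)} {rowDifferences (minor 0 j A)} {minor 0 j A′}
        (λ _ → refl) (λ _ _ → refl) (λ _ _ → refl))
      (+-congʳ ih)

  detℕ-factor : ∀ n A x → Σ< (suc n) (λ j → s j * (A 0 j * (x * detℕ n (minor 0 j A)))) ≈ x * detℕ (suc n) A
  detℕ-factor n A x = trans
    (Σ<-cong (suc n) λ j _ → solve 4 (λ σ a x d → σ :* (a :* (x :* d)) := x :* (σ :* (a :* d))) refl _ _ _ _)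
    (sym (*-distribˡ-Σ< (suc n) x _))

  detℕ-lastColumn : ∀ n A → (∀ k → k < n → A k n ≈ 0#) → detℕ (suc n) A ≈ A n n * detℕ n A
  detℕ-lastColumn zero    A _ = trans (detℕ-1 A) (sym (*-identityʳ _))
  detℕ-lastColumn (suc n) A column≈0 = begin
    detℕ (suc (suc n)) A
      ≈⟨ Σ<-last (suc n) _ ⟩
    Σ< (suc n) (λ j → s j * (A 0 j * detℕ (suc n) (minor 0 j A))) + s (suc n) * (A 0 (suc n) * detℕ (suc n) (minor 0 (suc n) A))
      ≈⟨ +-cong (Σ<-cong (suc n) λ j j≤n → *-congˡ (*-congˡ (trans (detℕ-lastColumn n (minor 0 j A) (minor-column j j≤n)) (*-congʳ (corner j j≤n)))))
                (trans (*-congˡ (trans (*-congʳ (column≈0 0 z<s)) (zeroˡ _))) (zeroʳ _)) ⟩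
    Σ< (suc n) (λ j → s j * (A 0 j * (A (suc n) (suc n) * detℕ n (minor 0 j A)))) + 0#
      ≈⟨ trans (+-identityʳ _) (detℕ-factor n A _) ⟩
    A (suc n) (suc n) * detℕ (suc n) A  ∎
    where
    minor-column : ∀ j → j < suc n → ∀ k → k < n → minor 0 j A k n ≈ 0#
    minor-column j j≤n k k<n = trans (reflexive (cong (A (suc k)) (punchInℕ-above (ℕ.≤-pred j≤n)))) (column≈0 (suc k) (s≤s k<n))
    corner : ∀ j → j < suc n → minor 0 j A n n ≈ A (suc n) (suc n)
    corner j j≤n = reflexive (cong (A (suc n)) (punchInℕ-above (ℕ.≤-pred j≤n)))

  detℕ-lastRow : ∀ n A → (∀ l → l < n → A n l ≈ 0#) → detℕ (suc n) A ≈ A n n * detℕ n A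
  detℕ-lastRow zero    A _ = trans (detℕ-1 A) (sym (*-identityʳ _))
  detℕ-lastRow (suc n) A row≈0 = begin
    detℕ (suc (suc n)) A
      ≈⟨ Σ<-last (suc n) _ ⟩
    Σ< (suc n) (λ j → s j * (A 0 j * detℕ (suc n) (minor 0 j A))) + s (suc n) * (A 0 (suc n) * detℕ (suc n) (minor 0 (suc n) A))
      ≈⟨ +-cong (Σ<-cong (suc n) λ j j≤n → *-congˡ (*-congˡ (trans (detℕ-lastRow n (minor 0 j A) (minor-row j j≤n)) (*-congʳ (corner j j≤n)))))
                (*-congˡ (*-congˡ (trans (detℕ-lastRow n (minor 0 (suc n) A) last-minor-row) (trans (*-congʳ last-corner) (zeroˡ _))))) ⟩
    Σ< (suc n) (λ j → s j * (A 0 j * (A (suc n) (suc n) * detℕ n (minor 0 j A)))) + s (suc n) * (A 0 (suc n) * 0#)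
      ≈⟨ +-cong (detℕ-factor n A _) (trans (*-congˡ (zeroʳ _)) (zeroʳ _)) ⟩
    A (suc n) (suc n) * detℕ (suc n) A + 0#
      ≈⟨ +-identityʳ _ ⟩
    A (suc n) (suc n) * detℕ (suc n) A  ∎
    where
    minor-row : ∀ j → j < suc n → ∀ l → l < n → minor 0 j A n l ≈ 0#
    minor-row j j≤n l l<n = row≈0 _ (punchInℕ-< (ℕ.≤-pred j≤n) l<n)
    corner : ∀ j → j < suc n → minor 0 j A n n ≈ A (suc n) (suc n)
    corner j j≤n = reflexive (cong (A (suc n)) (punchInℕ-above (ℕ.≤-pred j≤n)))
    last-minor-row : ∀ l → l < n → minor 0 (suc n) A n l ≈ 0#
    last-minor-row l l<n = trans (reflexive (cong (A (suc n)) (punchInℕ-below (ℕ.m<n⇒m<1+n l<n)))) (row≈0 l (ℕ.m<n⇒m<1+n l<n))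
    last-corner : minor 0 (suc n) A n n ≈ 0#
    last-corner = trans (reflexive (cong (A (suc n)) (punchInℕ-below (ℕ.n<1+n n)))) (row≈0 n (ℕ.n<1+n n))

  -- The matrix I − M_r after row differences

  δ : ℕ → ℕ → Carrier
  δ a b = if a ≡ᵇ b then 1# else 0#

  δ-refl : ∀ a → δ a a ≈ 1#
  δ-refl zero    = refl
  δ-refl (suc a) = δ-refl a

  δ-< : ∀ {a b} → a < b → δ a b ≈ 0#
  δ-< {zero}  {suc b} _ = refl
  δ-< {suc a} {suc b} (s≤s a<b) = δ-< a<b

  δ-> : ∀ {a b} → b < a → δ a b ≈ 0#
  δ-> {suc a} {zero}  _ = refl
  δ-> {suc a} {suc b} (s≤s b<a) = δ-> b<a

  δ-+suc : ∀ a b c → δ (a +ℕ suc b) c ≈ δ (suc (a +ℕ b)) c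
  δ-+suc a b c = reflexive (cong (λ n → δ n c) (ℕ.+-suc a b))

  I-M : ℕ → (ℕ → Carrier) → Matrix
  I-M r z k l = δ k l - (if suc r ≤ᵇ suc k +ℕ suc l then z l else 0#)

  xAt-suc-toℕ : ∀ r (x : Fin r → Carrier) j → xAt R r x (suc (toℕ j)) ≡ x j
  xAt-suc-toℕ (suc r) x zero    = ≡.refl
  xAt-suc-toℕ (suc r) x (suc j) = xAt-suc-toℕ r (λ j → x (suc j)) j

  D≈detℕ-I-M : ∀ r x → D R r x ≈ detℕ r (I-M r (λ l → xAt R r x (suc l)))
  D≈detℕ-I-M r x = det≈detℕ r λ i j → +-congˡ (-‿cong
    (reflexive (cong (λ y → if suc r ≤ᵇ suc (toℕ i) +ℕ suc (toℕ j) then y else 0#) (≡.sym (xAt-suc-toℕ r x j)))))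

  threshold-start : ∀ {l r} w → l ≤ r → (if r <ᵇ suc l then w else 0#) ≈ w * δ l r
  threshold-start {zero}  {zero}  w _ = sym (*-identityʳ w)
  threshold-start {zero}  {suc r} w _ = sym (zeroʳ w)
  threshold-start {suc l} {suc r} w (s≤s l≤r) = threshold-start w l≤r

  threshold-jump : ∀ r t w → (if r <ᵇ suc (suc t) then w else 0#) - (if r <ᵇ suc t then w else 0#) ≈ w * δ (suc t) r
  threshold-jump zero          t       w = trans (-‿inverseʳ w) (sym (zeroʳ w))
  threshold-jump (suc zero)    zero    w = solve 1 (λ w → w :- :0 := w :* :1) refl w
  threshold-jump (suc (suc r)) zero    w = solve 1 (λ w → :0 :- :0 := w :* :0) refl w
  threshold-jump (suc r)       (suc t) w = threshold-jump r t w

  -- What rowDifferences makes of I − M_m, by rowDifferences-I-M≈B.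
  B : ℕ → (ℕ → Carrier) → Matrix
  B m z k l = δ k l - δ k (suc l) - z l * δ (suc (k +ℕ l)) m

  H : ℕ → (ℕ → Carrier) → Matrix
  H m z k = B (suc m) z (suc k)

  rowDifferences-I-M≈B : ∀ r z k l → l < r → rowDifferences (I-M r z) k l ≈ B r z k l
  rowDifferences-I-M≈B r z zero l l<r = trans (+-congˡ (-‿cong (threshold-start (z l) l<r)))
    (solve 2 (λ d y → d :- y := d :- :0 :- y) refl _ _)
  rowDifferences-I-M≈B r z (suc k) l _ = begin
    (δ (suc k) l - step₂) - (δ k l - step₁)        ≈⟨ solve 4 (λ a b c d → (a :- b) :- (c :- d) := a :- c :- (b :- d)) refl _ _ _ _ ⟩
    δ (suc k) l - δ k l - (step₂ - step₁)          ≈⟨ +-congˡ (-‿cong (threshold-jump r (k +ℕ suc l) (z l))) ⟩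
    δ (suc k) l - δ k l - z l * δ (suc (k +ℕ suc l)) r   ≈⟨ +-congˡ (-‿cong (*-congˡ (reflexive (cong (λ n → δ (suc n) r) (ℕ.+-suc k l))))) ⟩
    B r z (suc k) l                                ∎
    where
    step₁ step₂ : Carrier
    step₁ = if r <ᵇ suc (k +ℕ suc l) then z l else 0#
    step₂ = if r <ᵇ suc (suc (k +ℕ suc l)) then z l else 0#

  D≈detℕ-B : ∀ r x → D R r x ≈ detℕ r (B r (λ l → xAt R r x (suc l)))
  D≈detℕ-B r x = begin
    D R r x                                   ≈⟨ D≈detℕ-I-M r x ⟩
    detℕ r (I-M r z)                          ≈⟨ detℕ-rowDifferences r (I-M r z) ⟨
    detℕ r (rowDifferences (I-M r z))         ≈⟨ detℕ-cong r (λ k l _ l<r → rowDifferences-I-M≈B r z k l l<r) ⟩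
    detℕ r (B r z)                            ∎
    where
    z : ℕ → Carrier
    z l = xAt R r x (suc l)

  entry-cong : ∀ {p p′ q q′ r r′} x → p ≈ p′ → q ≈ q′ → r ≈ r′ → p - q - x * r ≈ p′ - q′ - x * r′
  entry-cong x p≈p′ q≈q′ r≈r′ = +-cong (+-cong p≈p′ (-‿cong q≈q′)) (-‿cong (*-congˡ r≈r′))

  -- Row 0 of B (m + 2) z is (1, 0, …, 0, −z (m + 1)); the two minors that matter are B m z′
  -- bordered by a unit last column, and H (m + 1) z.
  B-recurrence : ∀ m z → detℕ (suc (suc m)) (B (suc (suc m)) z)
                         ≈ detℕ m (B m (λ l → z (suc l))) + s m * (z (suc m) * detℕ (suc m) (H (suc m) z))
  B-recurrence m z = Σ<-ends m first middle last
    where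
    A : Matrix
    A = B (suc (suc m)) z
    z′ : ℕ → Carrier
    z′ l = z (suc l)
    minor₀₀ : detℕ (suc m) (minor 0 0 A) ≈ detℕ m (B m z′)
    minor₀₀ = begin
      detℕ (suc m) (minor 0 0 A)
        ≈⟨ detℕ-lastColumn m (minor 0 0 A) (λ k k<m → trans
             (entry-cong _ (δ-< k<m) (δ-< (ℕ.m<n⇒m<1+n k<m)) (δ-> (m<n+1+m m k)))
             (solve 1 (λ x → :0 :- :0 :- x :* :0 := :0) refl _)) ⟩
      minor 0 0 A m m * detℕ m (minor 0 0 A)
        ≈⟨ *-cong (trans (entry-cong _ (δ-refl m) (δ-< (ℕ.n<1+n m)) (δ-> (m<n+1+m m m)))
                         (solve 1 (λ x → :1 :- :0 :- x :* :0 := :1) refl _))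
                  (detℕ-cong m (λ k l _ _ → +-congˡ (-‿cong (*-congˡ (δ-+suc k l m))))) ⟩
      1# * detℕ m (B m z′)
        ≈⟨ *-identityˡ _ ⟩
      detℕ m (B m z′)  ∎
    first : s 0 * (A 0 0 * detℕ (suc m) (minor 0 0 A)) ≈ detℕ m (B m z′)
    first = trans (*-congˡ (*-congˡ minor₀₀)) (solve 2 (λ x d → :1 :* ((:1 :- :0 :- x :* :0) :* d) := d) refl _ _)
    middle : ∀ j → j < m → s (suc j) * (A 0 (suc j) * detℕ (suc m) (minor 0 (suc j) A)) ≈ 0#
    middle j j<m = trans (*-congˡ (*-congʳ (trans (entry-cong _ refl refl (δ-< j<m))
                     (solve 1 (λ x → :0 :- :0 :- x :* :0 := :0) refl _))))
                   (solve 2 (λ σ d → σ :* (:0 :* d) := :0) refl _ _)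
    last : s (suc m) * (A 0 (suc m) * detℕ (suc m) (minor 0 (suc m) A)) ≈ s m * (z (suc m) * detℕ (suc m) (H (suc m) z))
    last = begin
      s (suc m) * (A 0 (suc m) * detℕ (suc m) (minor 0 (suc m) A))
        ≈⟨ *-cong (signPow-suc m) (*-cong (entry-cong _ refl refl (δ-refl m))
                  (detℕ-cong (suc m) λ k l _ l≤m → reflexive (cong (A (suc k)) (punchInℕ-below l≤m)))) ⟩
      - s m * ((0# - 0# - z (suc m) * 1#) * detℕ (suc m) (H (suc m) z))
        ≈⟨ solve 3 (λ σ x d → (:- σ) :* ((:0 :- :0 :- x :* :1) :* d) := σ :* (x :* d)) refl _ _ _ ⟩
      s m * (z (suc m) * detℕ (suc m) (H (suc m) z))  ∎

  -- Column 0 of H (m + 2) z is (−1, 0, …, 0, −z 0); the two minors that matter are H m z′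
  -- bordered by the last row (0, …, 0, −1), and B (m + 1) z′.
  H-recurrence : ∀ m z → detℕ (suc (suc m)) (H (suc (suc m)) z)
                         ≈ detℕ m (H m (λ l → z (suc l))) + s m * (z 0 * detℕ (suc m) (B (suc m) (λ l → z (suc l))))
  H-recurrence m z = trans (detℕ-expandColumn₀ (suc m) A) (Σ<-ends m first middle last)
    where
    A : Matrix
    A = H (suc (suc m)) z
    z′ : ℕ → Carrier
    z′ l = z (suc l)
    minor₀₀ : detℕ (suc m) (minor 0 0 A) ≈ - 1# * detℕ m (H m z′)
    minor₀₀ = begin
      detℕ (suc m) (minor 0 0 A)
        ≈⟨ detℕ-lastRow m (minor 0 0 A) (λ l l<m → trans
             (entry-cong _ (δ-> (ℕ.m<n⇒m<1+n l<m)) (δ-> l<m) (δ-> (ℕ.m<m+n m z<s)))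
             (solve 1 (λ x → :0 :- :0 :- x :* :0 := :0) refl _)) ⟩
      minor 0 0 A m m * detℕ m (minor 0 0 A)
        ≈⟨ *-cong (trans (entry-cong _ (δ-> (ℕ.n<1+n m)) (δ-refl m) (δ-> (ℕ.m<m+n m z<s)))
                         (solve 1 (λ x → :0 :- :1 :- x :* :0 := :- :1) refl _))
                  (detℕ-cong m (λ k l _ _ → +-congˡ (-‿cong (*-congˡ (δ-+suc k l m))))) ⟩
      - 1# * detℕ m (H m z′)  ∎
    first : s 0 * (A 0 0 * detℕ (suc m) (minor 0 0 A)) ≈ detℕ m (H m z′)
    first = trans (*-congˡ (*-congˡ minor₀₀)) (solve 2 (λ x d → :1 :* ((:0 :- :1 :- x :* :0) :* ((:- :1) :* d)) := d) refl _ _)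
    middle : ∀ j → j < m → s (suc j) * (A (suc j) 0 * detℕ (suc m) (minor (suc j) 0 A)) ≈ 0#
    middle j j<m = trans (*-congˡ (*-congʳ (trans (entry-cong _ refl refl (δ-< (subst (_< m) (≡.sym (ℕ.+-identityʳ j)) j<m)))
                     (solve 1 (λ x → :0 :- :0 :- x :* :0 := :0) refl _))))
                   (solve 2 (λ σ d → σ :* (:0 :* d) := :0) refl _ _)
    last : s (suc m) * (A (suc m) 0 * detℕ (suc m) (minor (suc m) 0 A)) ≈ s m * (z 0 * detℕ (suc m) (B (suc m) z′))
    last = begin
      s (suc m) * (A (suc m) 0 * detℕ (suc m) (minor (suc m) 0 A))
        ≈⟨ *-cong (signPow-suc m) (*-cong (entry-cong _ refl refl (trans (reflexive (cong (λ n → δ n m) (ℕ.+-identityʳ m))) (δ-refl m)))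
                  (detℕ-cong (suc m) λ k l k≤m _ → trans (reflexive (cong (λ i → A i (suc l)) (punchInℕ-below k≤m)))
                                                         (+-congˡ (-‿cong (*-congˡ (δ-+suc k l (suc m))))))) ⟩
      - s m * ((0# - 0# - z 0 * 1#) * detℕ (suc m) (B (suc m) z′))
        ≈⟨ solve 3 (λ σ x d → (:- σ) :* ((:0 :- :0 :- x :* :1) :* d) := σ :* (x :* d)) refl _ _ _ ⟩
      s m * (z 0 * detℕ (suc m) (B (suc m) z′))  ∎

  -- Sums over odd compositions

  -- Φ c Y r generalises φ_r: Y t plays x_{σ_r(t)}, and c shifts the exponent of the sign.
  weight : ℕ → (ℕ → Carrier) → List ℕ → Carrier
  weight c Y α = s ⌊ suc (c +ℕ length α) /2⌋ * prodL R (map Y (partialSums α))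

  oddWeight : ℕ → (ℕ → Carrier) → List ℕ → Carrier
  oddWeight c Y α = if allOdd α then weight c Y α else 0#

  oddSum : ℕ → ℕ → (ℕ → Carrier) → ℕ → Carrier
  oddSum fuel c Y n = ΣL (oddWeight c Y) (compsFuel fuel n)

  Φ : ℕ → (ℕ → Carrier) → ℕ → Carrier
  Φ c Y r = Σ< (suc r) (λ n → oddSum n c Y n)

  φ≈Φ : ∀ r x → φ R r x ≈ Φ 0 (λ t → xAt R r x (σ r t)) r
  φ≈Φ r x = begin
    φ R r x                                                        ≈⟨ ΣL-filter allOdd (weight 0 Y) (concatMap compositions (upTo (suc r))) ⟩
    ΣL (oddWeight 0 Y) (concatMap compositions (upTo (suc r)))     ≈⟨ ΣL-concatMap (oddWeight 0 Y) compositions (upTo (suc r)) ⟩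
    ΣL (λ n → oddSum n 0 Y n) (upTo (suc r))                       ≈⟨ ΣL-applyUpTo (λ n → oddSum n 0 Y n) (λ i → i) (suc r) ⟩
    Φ 0 Y r                                                        ∎
    where
    Y : ℕ → Carrier
    Y t = xAt R r x (σ r t)

  weight-cons : ∀ c Y a β → weight c Y (a ∷ β) ≈ Y a * weight (suc c) (λ t → Y (a +ℕ t)) β
  weight-cons c Y a β = begin
    s ⌊ suc (c +ℕ suc (length β)) /2⌋ * prodL R (map Y (partialSums (a ∷ β)))
      ≡⟨ cong₂ (λ n ps → s ⌊ suc n /2⌋ * prodL R (map Y ps)) (ℕ.+-suc c (length β)) (partialSums-cons a β) ⟩
    s ⌊ suc (suc c +ℕ length β) /2⌋ * (Y a * prodL R (map Y (map (a +ℕ_) (partialSums β))))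
      ≡⟨ cong (λ ys → s ⌊ suc (suc c +ℕ length β) /2⌋ * (Y a * prodL R ys)) (≡.sym (map-∘ (partialSums β))) ⟩
    s ⌊ suc (suc c +ℕ length β) /2⌋ * (Y a * prodL R (map (λ t → Y (a +ℕ t)) (partialSums β)))
      ≈⟨ solve 3 (λ σ y p → σ :* (y :* p) := y :* (σ :* p)) refl _ _ _ ⟩
    Y a * weight (suc c) (λ t → Y (a +ℕ t)) β  ∎

  oddWeight-cons : ∀ c Y k β → oddWeight c Y (suc k ∷ β)
                   ≈ (if isEven k then Y (suc k) * oddWeight (suc c) (λ t → Y (suc k +ℕ t)) β else 0#)
  oddWeight-cons c Y k β rewrite isEven-suc k with isEven k
  ... | false = refl
  ... | true with allOdd β
  ...   | true  = weight-cons c Y (suc k) β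
  ...   | false = sym (zeroʳ _)

  oddSum-firstPart : ∀ f c Y n → oddSum (suc f) c Y (suc n)
    ≈ Σ< (suc n) (λ k → if isEven k then Y (suc k) * oddSum f (suc c) (λ t → Y (suc k +ℕ t)) (n ∸ k) else 0#)
  oddSum-firstPart f c Y n = begin
    ΣL (oddWeight c Y) (concatMap startingWith (upTo (suc n)))
      ≈⟨ ΣL-concatMap (oddWeight c Y) startingWith (upTo (suc n)) ⟩
    ΣL (λ k → ΣL (oddWeight c Y) (startingWith k)) (upTo (suc n))
      ≈⟨ ΣL-applyUpTo _ (λ k → k) (suc n) ⟩
    Σ< (suc n) (λ k → ΣL (oddWeight c Y) (startingWith k))
      ≈⟨ Σ<-cong (suc n) (λ k _ → begin
           ΣL (oddWeight c Y) (startingWith k)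
             ≈⟨ ΣL-map (oddWeight c Y) (suc k ∷_) (compsFuel f (n ∸ k)) ⟩
           ΣL (λ β → oddWeight c Y (suc k ∷ β)) (compsFuel f (n ∸ k))
             ≈⟨ ΣL-cong (compsFuel f (n ∸ k)) (oddWeight-cons c Y k) ⟩
           ΣL (λ β → if isEven k then Y (suc k) * oddWeight (suc c) (λ t → Y (suc k +ℕ t)) β else 0#) (compsFuel f (n ∸ k))
             ≈⟨ ΣL-if (isEven k) (Y (suc k)) _ (compsFuel f (n ∸ k)) ⟩
           (if isEven k then Y (suc k) * oddSum f (suc c) (λ t → Y (suc k +ℕ t)) (n ∸ k) else 0#)  ∎) ⟩
    Σ< (suc n) (λ k → if isEven k then Y (suc k) * oddSum f (suc c) (λ t → Y (suc k +ℕ t)) (n ∸ k) else 0#)  ∎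
    where
    startingWith : ℕ → List (List ℕ)
    startingWith k = map (suc k ∷_) (compsFuel f (n ∸ k))

  oddSum-fuel : ∀ {f f′} c Y n → n ≤ f → n ≤ f′ → oddSum f c Y n ≈ oddSum f′ c Y n
  oddSum-fuel c Y n n≤f n≤f′ = reflexive (cong (ΣL (oddWeight c Y)) (compsFuel-fuel n≤f n≤f′))

  oddSum-sign : ∀ f c Y n → oddSum f (suc (suc c)) Y n ≈ - oddSum f c Y n
  oddSum-sign f c Y n = trans (ΣL-cong (compsFuel f n) flip-sign) (-‿ΣL (oddWeight c Y) (compsFuel f n))
    where
    flip-sign : ∀ α → oddWeight (suc (suc c)) Y α ≈ - oddWeight c Y α
    flip-sign α with allOdd α
    ... | true  = trans (*-congʳ (signPow-suc ⌊ suc (c +ℕ length α) /2⌋)) (sym (-‿distribˡ-* _ _))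
    ... | false = sym -0#≈0#

  oddSum-cong : ∀ f c {Y Y′} n → (∀ t → 1 ≤ t → t ≤ n → Y t ≈ Y′ t) → oddSum f c Y n ≈ oddSum f c Y′ n
  oddSum-cong zero    c zero    Y≈Y′ = refl
  oddSum-cong zero    c (suc n) Y≈Y′ = refl
  oddSum-cong (suc f) c zero    Y≈Y′ = refl
  oddSum-cong (suc f) c {Y} {Y′} (suc n) Y≈Y′ = begin
    oddSum (suc f) c Y (suc n)  ≈⟨ oddSum-firstPart f c Y n ⟩
    Σ< (suc n) (term Y)         ≈⟨ Σ<-cong (suc n) term-cong ⟩
    Σ< (suc n) (term Y′)        ≈⟨ oddSum-firstPart f c Y′ n ⟨
    oddSum (suc f) c Y′ (suc n) ∎
    where
    term : (ℕ → Carrier) → ℕ → Carrier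
    term Y k = if isEven k then Y (suc k) * oddSum f (suc c) (λ t → Y (suc k +ℕ t)) (n ∸ k) else 0#
    term-cong : ∀ k → k < suc n → term Y k ≈ term Y′ k
    term-cong k (s≤s k≤n) with isEven k
    ... | false = refl
    ... | true  = *-cong (Y≈Y′ (suc k) (s≤s z≤n) (s≤s k≤n))
      (oddSum-cong f (suc c) (n ∸ k) λ t _ t≤n∸k → Y≈Y′ (suc k +ℕ t) (s≤s z≤n)
        (s≤s (ℕ.≤-trans (ℕ.+-monoʳ-≤ k t≤n∸k) (ℕ.≤-reflexive (ℕ.m+[n∸m]≡n k≤n)))))

  oddSum-one : ∀ c Y → oddSum 1 c Y 1 ≈ Y 1 * oddSum 0 (suc c) (λ t → Y (suc t)) 0
  oddSum-one c Y = trans (oddSum-firstPart 0 c Y 0) (Σ<-one _)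

  -- The part of oddSum (n + 2) coming from first parts at least 3, with that part lowered by 2.
  longFirstPart : ℕ → ℕ → (ℕ → Carrier) → Carrier
  longFirstPart zero    c Y = 0#
  longFirstPart (suc n) c Y = oddSum (suc n) c (λ t → Y (suc (suc t))) (suc n)

  oddSum-split : ∀ n c Y → oddSum (suc (suc n)) c Y (suc (suc n))
                           ≈ Y 1 * oddSum (suc n) (suc c) (λ t → Y (suc t)) (suc n) + longFirstPart n c Y
  oddSum-split n c Y = trans (oddSum-firstPart (suc n) c Y (suc n))
    (trans (Σ<-suc (suc n) _) (+-congˡ (trans (Σ<-suc n _) (trans (+-identityˡ _) (long n)))))
    where
    term : ℕ → ℕ → Carrier
    term n k = if isEven k then Y (suc k) * oddSum (suc n) (suc c) (λ t → Y (suc k +ℕ t)) (suc n ∸ k) else 0#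
    long : ∀ n → Σ< n (λ k → term n (suc (suc k))) ≈ longFirstPart n c Y
    long zero    = Σ<-0 _
    long (suc m) = trans (Σ<-cong (suc m) λ k k≤m → if-cong (isEven-suc-suc k)
        (*-congˡ (oddSum-fuel (suc c) _ (m ∸ k) (ℕ.≤-trans (ℕ.m∸n≤m m k) (ℕ.≤-trans (ℕ.n≤1+n m) (ℕ.n≤1+n (suc m)))) (ℕ.m∸n≤m m k))))
      (sym (oddSum-firstPart m c (λ t → Y (suc (suc t))) m))

  Φ-cong : ∀ c {Y Y′} r → (∀ t → 1 ≤ t → t ≤ r → Y t ≈ Y′ t) → Φ c Y r ≈ Φ c Y′ r
  Φ-cong c r Y≈Y′ = Σ<-cong (suc r) λ n n≤r →
    oddSum-cong n c n (λ t 1≤t t≤n → Y≈Y′ t 1≤t (ℕ.≤-trans t≤n (ℕ.≤-pred n≤r)))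

  Φ-sign : ∀ c Y r → Φ (suc (suc c)) Y r ≈ - Φ c Y r
  Φ-sign c Y r = trans (Σ<-cong (suc r) (λ n _ → oddSum-sign n c Y n)) (-‿Σ< (suc r) _)

  Φ-zero : ∀ c Y → Φ c Y 0 ≈ oddSum 0 c Y 0
  Φ-zero c Y = Σ<-one _

  Φ-one : ∀ c Y → Φ c Y 1 ≈ oddSum 0 c Y 0 + Y 1 * oddSum 0 (suc c) (λ t → Y (suc t)) 0
  Φ-one c Y = trans (Σ<-suc 1 _) (+-congˡ (trans (Σ<-one _) (oddSum-one c Y)))

  Φ-recurrence : ∀ c Y r → Φ c Y (suc (suc r)) ≈ Φ c (λ t → Y (suc (suc t))) r + Y 1 * Φ (suc c) (λ t → Y (suc t)) (suc r)
  Φ-recurrence c Y r = begin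
    Φ c Y (suc (suc r))
      ≈⟨ trans (Σ<-suc (suc (suc r)) _) (+-congˡ (Σ<-suc (suc r) _)) ⟩
    O 0 + (oddSum 1 c Y 1 + Σ< (suc r) (λ n → oddSum (suc (suc n)) c Y (suc (suc n))))
      ≈⟨ +-congˡ (+-cong (oddSum-one c Y) (Σ<-cong (suc r) (λ n _ → oddSum-split n c Y))) ⟩
    O 0 + (Y 1 * O′ 0 + Σ< (suc r) (λ n → Y 1 * O′ (suc n) + longFirstPart n c Y))
      ≈⟨ +-congˡ (+-congˡ (trans (Σ<-distrib-+ (suc r) _ _) (+-cong (sym (*-distribˡ-Σ< (suc r) (Y 1) _)) (Σ<-suc r _)))) ⟩
    O 0 + (Y 1 * O′ 0 + (Y 1 * Σ< (suc r) (λ n → O′ (suc n)) + (0# + Σ< r (λ n → O₂ (suc n)))))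
      ≈⟨ solve 5 (λ a y b d e → a :+ (y :* b :+ (y :* d :+ (:0 :+ e))) := (a :+ e) :+ y :* (b :+ d)) refl _ _ _ _ _ ⟩
    (O 0 + Σ< r (λ n → O₂ (suc n))) + Y 1 * (O′ 0 + Σ< (suc r) (λ n → O′ (suc n)))
      ≈⟨ +-cong (Σ<-suc r _) (*-congˡ (Σ<-suc (suc r) _)) ⟨
    Φ c (λ t → Y (suc (suc t))) r + Y 1 * Φ (suc c) (λ t → Y (suc t)) (suc r)  ∎
    where
    O O′ O₂ : ℕ → Carrier
    O n = oddSum n c Y n
    O′ n = oddSum n (suc c) (λ t → Y (suc t)) n
    O₂ n = oddSum n c (λ t → Y (suc (suc t))) n

  -- The recurrences agree

  -- Φ with the variables indexed from 0, as in the matrices.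
  Φ₀ : ℕ → (ℕ → Carrier) → ℕ → Carrier
  Φ₀ c y r = Φ c (λ t → y (t ∸ 1)) r

  Φ₀-recurrence : ∀ c y r → Φ₀ c y (suc (suc r)) ≈ Φ₀ c (λ p → y (suc (suc p))) r + y 0 * Φ₀ (suc c) (λ p → y (suc p)) (suc r)
  Φ₀-recurrence c y r = trans (Φ-recurrence c _ r)
    (+-cong (Φ-cong c r λ { (suc t) _ _ → refl }) (*-congˡ (Φ-cong (suc c) (suc r) λ { (suc t) _ _ → refl })))

  mutual
    detℕ-B≈Φ₀ : ∀ m z → detℕ m (B m z) ≈ Φ₀ 0 (λ p → z (lastFirst m p)) m
    detℕ-B≈Φ₀ zero          z = sym (trans (Φ-zero 0 _) (solve 0 (:1 :* :1 :+ :0 := :1) refl))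
    detℕ-B≈Φ₀ (suc zero)    z = trans (detℕ-1 (B 1 z)) (sym (trans (Φ-one 0 _)
      (solve 1 (λ x → :1 :* :1 :+ :0 :+ x :* ((:- :1) :* :1 :+ :0) := :1 :- :0 :- x :* :1) refl (z 0))))
    detℕ-B≈Φ₀ (suc (suc m)) z = begin
      detℕ (suc (suc m)) (B (suc (suc m)) z)
        ≈⟨ B-recurrence m z ⟩
      detℕ m (B m z′) + s m * (z (suc m) * detℕ (suc m) (H (suc m) z))
        ≈⟨ +-cong (detℕ-B≈Φ₀ m z′) (*-congˡ (*-congˡ (trans (detℕ-H≈Φ₀ (suc m) z) (*-congʳ (-‿cong (signPow-suc m)))))) ⟩
      Φ₀ 0 y₂ m + s m * (z (suc m) * (- - s m * Φ₀ 1 y₁ (suc m)))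
        ≈⟨ solve 4 (λ a σ x b → a :+ σ :* (x :* ((:- (:- σ)) :* b)) := a :+ (σ :* σ) :* (x :* b)) refl _ _ _ _ ⟩
      Φ₀ 0 y₂ m + s m * s m * (z (suc m) * Φ₀ 1 y₁ (suc m))
        ≈⟨ +-congˡ (trans (*-congʳ (signPow-square m)) (*-identityˡ _)) ⟩
      Φ₀ 0 y₂ m + z (suc m) * Φ₀ 1 y₁ (suc m)
        ≈⟨ Φ₀-recurrence 0 (λ p → z (lastFirst (suc (suc m)) p)) m ⟨
      Φ₀ 0 (λ p → z (lastFirst (suc (suc m)) p)) (suc (suc m))  ∎
      where
      z′ y₁ y₂ : ℕ → Carrier
      z′ l = z (suc l)
      y₁ p = z (firstLast (suc m) p)
      y₂ p = z′ (lastFirst m p)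

    detℕ-H≈Φ₀ : ∀ m z → detℕ m (H m z) ≈ - s m * Φ₀ 1 (λ p → z (firstLast m p)) m
    detℕ-H≈Φ₀ zero          z = sym (trans (*-congˡ (Φ-zero 1 _)) (solve 0 ((:- :1) :* ((:- :1) :* :1 :+ :0) := :1) refl))
    detℕ-H≈Φ₀ (suc zero)    z = trans (detℕ-1 (H 1 z)) (sym (trans (*-congˡ (Φ-one 1 _))
      (solve 1 (λ x → (:- (:- :1)) :* ((:- :1) :* :1 :+ :0 :+ x :* ((:- :1) :* :1 :+ :0)) := :0 :- :1 :- x :* :1) refl (z 0))))
    detℕ-H≈Φ₀ (suc (suc m)) z = begin
      detℕ (suc (suc m)) (H (suc (suc m)) z)
        ≈⟨ H-recurrence m z ⟩
      detℕ m (H m z′) + s m * (z 0 * detℕ (suc m) (B (suc m) z′))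
        ≈⟨ +-cong (detℕ-H≈Φ₀ m z′) (*-congˡ (*-congˡ (detℕ-B≈Φ₀ (suc m) z′))) ⟩
      - s m * Φ₀ 1 y₂ m + s m * (z 0 * Φ₀ 0 y₁ (suc m))
        ≈⟨ solve 4 (λ σ a x b → (:- σ) :* a :+ σ :* (x :* b) := (:- σ) :* (a :+ x :* (:- b))) refl _ _ _ _ ⟩
      - s m * (Φ₀ 1 y₂ m + z 0 * - Φ₀ 0 y₁ (suc m))
        ≈⟨ *-cong (-‿cong s[m+2]≈s[m]) (+-congˡ (*-congˡ (Φ-sign 0 _ (suc m)))) ⟨
      - s (suc (suc m)) * (Φ₀ 1 y₂ m + z 0 * Φ₀ 2 y₁ (suc m))
        ≈⟨ *-congˡ (Φ₀-recurrence 1 (λ p → z (firstLast (suc (suc m)) p)) m) ⟨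
      - s (suc (suc m)) * Φ₀ 1 (λ p → z (firstLast (suc (suc m)) p)) (suc (suc m))  ∎
      where
      z′ y₁ y₂ : ℕ → Carrier
      z′ l = z (suc l)
      y₁ p = z′ (lastFirst (suc m) p)
      y₂ p = z′ (firstLast m p)
      s[m+2]≈s[m] : s (suc (suc m)) ≈ s m
      s[m+2]≈s[m] = trans (signPow-suc (suc m)) (trans (-‿cong (signPow-suc m)) (-‿involutive _))

theorem2p22 : ∀ {c ℓ} (R : CommutativeRing c ℓ) (r : ℕ) → 1 ≤ r →
    (x : Fin r → CommutativeRing.Carrier R) →
    CommutativeRing._≈_ R (D R r x) (φ R r x)
theorem2p22 R r _ x = begin
  D R r x                                   ≈⟨ D≈detℕ-B R r x ⟩
  detℕ R r (B R r z)                        ≈⟨ detℕ-B≈Φ₀ R r z ⟩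
  Φ₀ R 0 (λ p → z (lastFirst r p)) r        ≈⟨ Φ-cong R 0 r interleaving ⟩
  Φ R 0 (λ t → xAt R r x (σ r t)) r         ≈⟨ φ≈Φ R r x ⟨
  φ R r x                                   ∎
  where
  open CommutativeRing R
  open import Relation.Binary.Reasoning.Setoid setoid
  z : ℕ → Carrier
  z l = xAt R r x (suc l)
  interleaving : ∀ t → 1 ≤ t → t ≤ r → z (lastFirst r (t ∸ 1)) ≈ xAt R r x (σ r t)
  interleaving (suc p) _ p<r = reflexive (cong (xAt R r x) (≡.sym (σ-lastFirst r p p<r)))
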